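{- Let ${\cal K}$ be a finite abelian group (in the paper, a subgroup of the character group $\hat G$ of a finite abelian group $G$), let ${\cal Z}$ be a proper subset of ${\cal K}$, and write ${\cal N}={\cal K}\setminus{\cal Z}$. Then: (i) there exists a ${\cal Z}$-independent subset of ${\cal K}$ of size at least $|{\cal K}|/|{\cal N}|$, that is, $\delta({\cal K},{\cal Z})\ge|{\cal K}|/(|{\cal K}|-|{\cal Z}|)$; (ii) if $|{\cal N}|$ divides $|{\cal K}|$ and the maximum size of a ${\cal Z}$-independent subset of ${\cal K}$ is $|{\cal K}|/|{\cal N}|$, then ${\cal N}$ is a coset of a subgroup of ${\cal K}$.
   Context: ${\cal Z}$-independent subsets of ${\cal K}$ are defined inductively: $\emptyset$ is ${\cal Z}$-independent; if ${\cal A}$ is ${\cal Z}$-independent and $\psi\in{\cal K}$ then $\psi+{\cal A}=\{\psi+\alpha:\alpha\in{\cal A}\}$ is ${\cal Z}$-independent; if ${\cal A}\subseteq{\cal Z}$ is ${\cal Z}$-independent and $\eta\in{\cal K}\setminus{\cal Z}$ then ${\cal A}\cup\{\eta\}$ is ${\cal Z}$-independent; only sets so obtained are ${\cal Z}$-independent. $\delta({\cal K},{\cal Z})$ is the largest size of a ${\cal Z}$-independent subset of ${\cal K}$. -}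

module Defs where

open import Data.Nat using (ℕ)
open import Data.Fin using (Fin)
open import Data.Fin.Subset using (Subset; _∈_; _∉_; _⊆_; _∪_; ⁅_⁆; ⊥)
open import Data.Product using (Σ; ∃; _×_; _,_)
open import Function.Bundles using (_⇔_)
open import Relation.Binary.PropositionalEquality using (_≡_)
open import Algebra.Structures using (IsAbelianGroup)

-- A finite abelian group, presented (up to isomorphism) as an abelian
-- group structure on the finite carrier Fin n, with propositional equality.
record FinAbGroup : Set where
  field
    n      : ℕ
    _+_    : Fin n → Fin n → Fin n
    0#     : Fin n
    -_     : Fin n → Fin n
    isAbelianGroup : IsAbelianGroup _≡_ _+_ 0# -_

module _ (K : FinAbGroup) where
  open FinAbGroup K

  IsTranslate : Fin n → Subset n → Subset n → Set
  IsTranslate ψ A B = ∀ x → (x ∈ B ⇔ Σ (Fin n) (λ α → α ∈ A × x ≡ ψ + α))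

  data ZIndependent (Z : Subset n) : Subset n → Set where
    empty : ZIndependent Z ⊥
    shift : ∀ {A B} (ψ : Fin n) → ZIndependent Z A → IsTranslate ψ A B →
            ZIndependent Z B
    adjoin : ∀ {A} (η : Fin n) → ZIndependent Z A → A ⊆ Z → η ∉ Z →
             ZIndependent Z (A ∪ ⁅ η ⁆)

  IsSubgroup : Subset n → Set
  IsSubgroup H = (0# ∈ H) × (∀ {x y} → x ∈ H → y ∈ H → (x + y) ∈ H)
                 × (∀ {x} → x ∈ H → (- x) ∈ H)

  IsCoset : Subset n → Set
  IsCoset N = Σ (Subset n) λ H → IsSubgroup H × ∃ λ g → IsTranslate g H N

module Submission where

-- If ψ + A ⊆ Z and ψ + b ∉ Z, then A ∪ {b} is Z-independent: translate A by ψ, adjoin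
-- ψ + b, and translate back. Growing an independent set this way until every translate
-- ψ + A meets N = K ∖ Z and counting the pairs (ψ, a) ∈ K × A with ψ + a ∈ N gives
-- |K| ≤ |A| |N|, with strict inequality if some translate meets N twice. So if no
-- independent set is larger than |K| / |N| and y + a, y + b ∈ N, no ψ can separate a
-- from b (otherwise {a, b} is independent and grows into such a set A with y + A
-- meeting N twice).
-- Hence y, y + α ∈ N puts α in the stabiliser of N, and N is a coset of it.

open import Defs
open import Data.Nat using (ℕ; _*_; _≤_; _≥_)
open import Data.Nat.Divisibility using (_∣_; quotient)
open import Data.Fin using (Fin)
open import Data.Fin.Subset using (Subset; _∉_; ∁; ∣_∣)
open import Data.Product using (Σ; ∃; _×_)
open import Relation.Binary.PropositionalEquality using (_≡_)

open import Algebra.Bundles using (Group)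
open import Algebra.Structures using (IsAbelianGroup)
import Algebra.Properties.Group as GroupProperties
open import Data.Empty using (⊥-elim)
open import Data.Fin using (zero; suc; punchIn; punchOut)
open import Data.Fin.Permutation using (permutation)
open import Data.Fin.Properties using (all?; any?; ¬∀⟶∃¬; punchIn-punchOut)
open import Data.Fin.Subset using (_∈_; _⊆_; _∪_; ⁅_⁆; ⊥)
open import Data.Fin.Subset.Properties
  using (_∈?_; ∉⊥; x∈⁅x⁆; x∈⁅y⁆⇒x≡y; p⊆p∪q; x∈p∪q⁺; x∈p∪q⁻; x∈∁p⇒x∉p; x∉p⇒x∈∁p;
         ∣p∣≤n; p⊂q⇒∣p∣<∣q∣)
open import Data.Nat as ℕ using (suc; _<_; z≤n)
open import Data.Nat.Divisibility using (divides)
open import Data.Nat.Properties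
  using (+-*-semiring; ≤-trans; ≤-reflexive; <⇒≱; m≤m+n; +-suc; +-mono-≤; +-mono-<-≤;
         +-monoʳ-≤; *-monoˡ-≤; module ≤-Reasoning)
open import Data.Product using (_,_; proj₁; proj₂)
open import Data.Sum using (_⊎_; inj₁; inj₂)
open import Data.Vec using (lookup; tabulate; _∷_; [])
open import Data.Vec.Functional using (removeAt)
open import Data.Vec.Properties using ([]=⇒lookup; lookup⇒[]=; lookup∘tabulate)
open import Data.Bool using (true; false; if_then_else_)
open import Function using (id; _∘_)
open import Function.Bundles using (mk⇔; Equivalence)
open import Relation.Binary.PropositionalEquality using (refl; sym; trans; cong; cong₂; subst; _≢_; module ≡-Reasoning)
open import Relation.Nullary using (Dec; yes; no; does; proof)
open import Relation.Nullary.Reflects using (Reflects; invert)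
open import Relation.Nullary.Decidable using (_×-dec_; _→-dec_; ¬?; dec-true; decidable-stable)
open import Relation.Unary using (Pred; Decidable)
open import Algebra.Properties.Semiring.Sum +-*-semiring
  using (sum; sum-cong-≗; sum-remove; ∑-comm; ∑-permute; *-distribˡ-sum; *-distribʳ-sum)

sum-mono-≤ : ∀ {k} {f g : Fin k → ℕ} → (∀ i → f i ≤ g i) → sum f ≤ sum g
sum-mono-≤ {ℕ.zero} f≤g = z≤n
sum-mono-≤ {suc k} f≤g = +-mono-≤ (f≤g zero) (sum-mono-≤ (f≤g ∘ suc))

sum-mono-< : ∀ {k} {f g : Fin k → ℕ} → (∀ i → f i ≤ g i) → ∀ j → f j < g j → sum f < sum g
sum-mono-< {suc k} {f} {g} f≤g j fj<gj = begin-strict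
  sum f                       ≡⟨ sum-remove f ⟩
  f j ℕ.+ sum (removeAt f j)  <⟨ +-mono-<-≤ fj<gj (sum-mono-≤ (f≤g ∘ punchIn j)) ⟩
  g j ℕ.+ sum (removeAt g j)  ≡⟨ sum-remove g ⟨
  sum g                       ∎
  where open ≤-Reasoning

term≤sum : ∀ {k} (f : Fin k → ℕ) i → f i ≤ sum f
term≤sum {suc k} f i = ≤-trans (m≤m+n (f i) _) (≤-reflexive (sym (sum-remove f)))

two-terms≤sum : ∀ {k} (f : Fin k → ℕ) {i j} → i ≢ j → f i ℕ.+ f j ≤ sum f
two-terms≤sum {suc k} f {i} {j} i≢j = begin
  f i ℕ.+ f j                                  ≡⟨ cong (λ l → f i ℕ.+ f l) (punchIn-punchOut i≢j) ⟨
  f i ℕ.+ removeAt f i (punchOut i≢j)          ≤⟨ +-monoʳ-≤ (f i) (term≤sum (removeAt f i) _) ⟩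
  f i ℕ.+ sum (removeAt f i)                   ≡⟨ sum-remove f ⟨
  sum f                                        ∎
  where open ≤-Reasoning

sum-ones : ∀ k → sum {k} (λ _ → 1) ≡ k
sum-ones ℕ.zero = refl
sum-ones (suc k) = cong suc (sum-ones k)

module _ {k} {ℓ} {P : Pred (Fin k) ℓ} (P? : Decidable P) where

  decSubset : Subset k
  decSubset = tabulate (does ∘ P?)

  ∈-decSubset⁺ : ∀ {x} → P x → x ∈ decSubset
  ∈-decSubset⁺ {x} Px = lookup⇒[]= x decSubset (trans (lookup∘tabulate (does ∘ P?) x) (dec-true (P? x) Px))

  ∈-decSubset⁻ : ∀ {x} → x ∈ decSubset → P x
  ∈-decSubset⁻ {x} x∈ = invert (subst (Reflects (P x)) does≡true (proof (P? x)))
    where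
    does≡true : does (P? x) ≡ true
    does≡true = trans (sym (lookup∘tabulate (does ∘ P?) x)) ([]=⇒lookup x∈)

indicator : ∀ {k} → Subset k → Fin k → ℕ
indicator p x = if lookup p x then 1 else 0

∣p∣≡∑indicator : ∀ {k} (p : Subset k) → ∣ p ∣ ≡ sum (indicator p)
∣p∣≡∑indicator [] = refl
∣p∣≡∑indicator (true ∷ p) = cong suc (∣p∣≡∑indicator p)
∣p∣≡∑indicator (false ∷ p) = ∣p∣≡∑indicator p

indicator-∈ : ∀ {k} {p : Subset k} {x} → x ∈ p → indicator p x ≡ 1
indicator-∈ x∈p rewrite []=⇒lookup x∈p = refl

module _ (K : FinAbGroup) where
  open FinAbGroup K renaming (_+_ to _⊕_; -_ to ⊖_)
  open IsAbelianGroup isAbelianGroup using (assoc; identityʳ; isGroup)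

  group : Group _ _
  group = record { isGroup = isGroup }

  open GroupProperties group using (\\-leftDividesˡ; \\-leftDividesʳ; //-rightDividesˡ; //-rightDividesʳ)

  translatedFrom? : ∀ ψ A x → Dec (((⊖ ψ) ⊕ x) ∈ A)
  translatedFrom? ψ A x = ((⊖ ψ) ⊕ x) ∈? A

  translate : Fin n → Subset n → Subset n
  translate ψ A = decSubset (translatedFrom? ψ A)

  translate-isTranslate : ∀ ψ A → IsTranslate K ψ A (translate ψ A)
  translate-isTranslate ψ A x = mk⇔
    (λ x∈ψ+A → (⊖ ψ) ⊕ x , ∈-decSubset⁻ (translatedFrom? ψ A) x∈ψ+A , sym (\\-leftDividesˡ ψ x))
    (λ { (α , α∈A , refl) → ∈-decSubset⁺ (translatedFrom? ψ A) (subst (_∈ A) (sym (\\-leftDividesʳ ψ α)) α∈A) })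

  isTranslate-inverse : ∀ {ψ A B} → IsTranslate K ψ A B → IsTranslate K (⊖ ψ) B A
  isTranslate-inverse {ψ} {A} {B} B≈ψ+A x = mk⇔
    (λ x∈A → ψ ⊕ x , Equivalence.from (B≈ψ+A (ψ ⊕ x)) (x , x∈A , refl) , sym (\\-leftDividesʳ ψ x))
    (λ { (β , β∈B , refl) → from-B β∈B })
    where
    from-B : ∀ {β} → β ∈ B → ((⊖ ψ) ⊕ β) ∈ A
    from-B β∈B with Equivalence.to (B≈ψ+A _) β∈B
    ... | α , α∈A , refl = subst (_∈ A) (sym (\\-leftDividesʳ ψ α)) α∈A

  isTranslate-∪⁅⁆ : ∀ {ψ A B} a → IsTranslate K ψ A B → IsTranslate K ψ (A ∪ ⁅ a ⁆) (B ∪ ⁅ ψ ⊕ a ⁆)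
  isTranslate-∪⁅⁆ {ψ} {A} {B} a B≈ψ+A x = mk⇔ to from
    where
    to : x ∈ B ∪ ⁅ ψ ⊕ a ⁆ → Σ (Fin n) λ α → α ∈ A ∪ ⁅ a ⁆ × x ≡ ψ ⊕ α
    to x∈ with x∈p∪q⁻ B _ x∈
    ... | inj₁ x∈B with Equivalence.to (B≈ψ+A x) x∈B
    ...   | α , α∈A , x≡ψ+α = α , x∈p∪q⁺ (inj₁ α∈A) , x≡ψ+α
    to x∈ | inj₂ x∈ψ+a = a , x∈p∪q⁺ (inj₂ (x∈⁅x⁆ a)) , x∈⁅y⁆⇒x≡y _ x∈ψ+a
    from : (Σ (Fin n) λ α → α ∈ A ∪ ⁅ a ⁆ × x ≡ ψ ⊕ α) → x ∈ B ∪ ⁅ ψ ⊕ a ⁆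
    from (α , α∈ , refl) with x∈p∪q⁻ A _ α∈
    ... | inj₁ α∈A = x∈p∪q⁺ (inj₁ (Equivalence.from (B≈ψ+A _) (α , α∈A , refl)))
    ... | inj₂ α∈⁅a⁆ rewrite x∈⁅y⁆⇒x≡y a α∈⁅a⁆ = x∈p∪q⁺ (inj₂ (x∈⁅x⁆ (ψ ⊕ a)))

  Stabilises : Subset n → Fin n → Set
  Stabilises S a = ∀ x → (x ∈ S → (x ⊕ a) ∈ S) × ((x ⊕ a) ∈ S → x ∈ S)

  stabilises? : ∀ S a → Dec (Stabilises S a)
  stabilises? S a = all? λ x → ((x ∈? S) →-dec ((x ⊕ a) ∈? S)) ×-dec (((x ⊕ a) ∈? S) →-dec (x ∈? S))

  stabiliser : Subset n → Subset n
  stabiliser S = decSubset (stabilises? S)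

  stabiliser-isSubgroup : ∀ S → IsSubgroup K (stabiliser S)
  stabiliser-isSubgroup S =
    ∈⁺ stabilises-0# , (λ a∈ b∈ → ∈⁺ (stabilises-⊕ (∈⁻ a∈) (∈⁻ b∈))) , ∈⁺ ∘ stabilises-⊖ ∘ ∈⁻
    where
    ∈⁺ = ∈-decSubset⁺ (stabilises? S)
    ∈⁻ = ∈-decSubset⁻ (stabilises? S)
    stabilises-0# : Stabilises S 0#
    stabilises-0# x = subst (_∈ S) (sym (identityʳ x)) , subst (_∈ S) (identityʳ x)
    stabilises-⊕ : ∀ {a b} → Stabilises S a → Stabilises S b → Stabilises S (a ⊕ b)
    stabilises-⊕ {a} {b} sa sb x =
      (λ x∈S → subst (_∈ S) (assoc x a b) (proj₁ (sb (x ⊕ a)) (proj₁ (sa x) x∈S))) ,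
      (λ x+ab∈S → proj₂ (sa x) (proj₂ (sb (x ⊕ a)) (subst (_∈ S) (sym (assoc x a b)) x+ab∈S)))
    stabilises-⊖ : ∀ {a} → Stabilises S a → Stabilises S (⊖ a)
    stabilises-⊖ {a} sa x =
      (λ x∈S → proj₂ (sa (x ⊕ (⊖ a))) (subst (_∈ S) (sym (//-rightDividesˡ a x)) x∈S)) ,
      (λ x-a∈S → subst (_∈ S) (//-rightDividesˡ a x) (proj₁ (sa (x ⊕ (⊖ a))) x-a∈S))

  isCoset-stabiliser : ∀ {S g} → g ∈ S → (∀ {α} → (g ⊕ α) ∈ S → α ∈ stabiliser S) → IsCoset K S
  isCoset-stabiliser {S} {g} g∈S g+α∈S⇒α∈H = stabiliser S , stabiliser-isSubgroup S , g , S≈g+H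
    where
    S≈g+H : IsTranslate K g (stabiliser S) S
    S≈g+H x = mk⇔
      (λ x∈S → (⊖ g) ⊕ x , g+α∈S⇒α∈H (subst (_∈ S) (sym (\\-leftDividesˡ g x)) x∈S) , sym (\\-leftDividesˡ g x))
      (λ { (α , α∈H , refl) → proj₁ (∈-decSubset⁻ (stabilises? S) α∈H g) g∈S })

  sum-translate : ∀ a (f : Fin n → ℕ) → sum (λ ψ → f (ψ ⊕ a)) ≡ sum f
  sum-translate a f = sym (∑-permute f (permutation (_⊕ a) (_⊕ (⊖ a)) (//-rightDividesˡ a) (//-rightDividesʳ a)))

  incidence : Subset n → Subset n → Fin n → Fin n → ℕ
  incidence A S ψ a = indicator A a * indicator S (ψ ⊕ a)

  hits : Subset n → Subset n → Fin n → ℕ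
  hits A S ψ = sum (incidence A S ψ)

  ∑-hits : ∀ A S → sum (hits A S) ≡ ∣ A ∣ * ∣ S ∣
  ∑-hits A S = begin
    sum (λ ψ → sum λ a → indicator A a * indicator S (ψ ⊕ a))  ≡⟨ ∑-comm (incidence A S) ⟩
    sum (λ a → sum λ ψ → indicator A a * indicator S (ψ ⊕ a))  ≡⟨ sum-cong-≗ (λ a → *-distribˡ-sum (indicator A a) (indicator-⊕ a)) ⟨
    sum (λ a → indicator A a * sum λ ψ → indicator S (ψ ⊕ a))  ≡⟨ sum-cong-≗ (cong (indicator A _ *_) ∘ sum-indicator-⊕) ⟩
    sum (λ a → indicator A a * ∣ S ∣)                          ≡⟨ *-distribʳ-sum ∣ S ∣ (indicator A) ⟨
    sum (indicator A) * ∣ S ∣                                  ≡⟨ cong (_* ∣ S ∣) (∣p∣≡∑indicator A) ⟨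
    ∣ A ∣ * ∣ S ∣                                              ∎
    where
    open ≡-Reasoning
    indicator-⊕ : Fin n → Fin n → ℕ
    indicator-⊕ a ψ = indicator S (ψ ⊕ a)
    sum-indicator-⊕ : ∀ a → sum (indicator-⊕ a) ≡ ∣ S ∣
    sum-indicator-⊕ a = trans (sum-translate a (indicator S)) (sym (∣p∣≡∑indicator S))

  TranslatesMeet : Subset n → Subset n → Set
  TranslatesMeet A S = ∀ ψ → ∃ λ a → a ∈ A × (ψ ⊕ a) ∈ S

  hit : ∀ {A S ψ a} → a ∈ A → (ψ ⊕ a) ∈ S → incidence A S ψ a ≡ 1
  hit a∈A ψ+a∈S rewrite indicator-∈ a∈A | indicator-∈ ψ+a∈S = refl

  meets⇒hits≥1 : ∀ {A S} → TranslatesMeet A S → ∀ ψ → 1 ≤ hits A S ψ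
  meets⇒hits≥1 {A} {S} cov ψ with cov ψ
  ... | a , a∈A , ψ+a∈S = subst (_≤ hits A S ψ) (hit a∈A ψ+a∈S) (term≤sum (incidence A S ψ) a)

  meets⇒n≤∣A∣*∣S∣ : ∀ {A S} → TranslatesMeet A S → n ≤ ∣ A ∣ * ∣ S ∣
  meets⇒n≤∣A∣*∣S∣ {A} {S} cov = begin
    n                  ≡⟨ sum-ones n ⟨
    sum {n} (λ _ → 1)  ≤⟨ sum-mono-≤ (meets⇒hits≥1 cov) ⟩
    sum (hits A S)     ≡⟨ ∑-hits A S ⟩
    ∣ A ∣ * ∣ S ∣      ∎
    where open ≤-Reasoning

  meets-twice⇒n<∣A∣*∣S∣ : ∀ {A S ψ a b} → TranslatesMeet A S → a ≢ b → a ∈ A → b ∈ A →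
                          (ψ ⊕ a) ∈ S → (ψ ⊕ b) ∈ S → n < ∣ A ∣ * ∣ S ∣
  meets-twice⇒n<∣A∣*∣S∣ {A} {S} {ψ} cov a≢b a∈A b∈A ψ+a∈S ψ+b∈S = begin-strict
    n                  ≡⟨ sum-ones n ⟨
    sum {n} (λ _ → 1)  <⟨ sum-mono-< (meets⇒hits≥1 cov) ψ hits≥2 ⟩
    sum (hits A S)     ≡⟨ ∑-hits A S ⟩
    ∣ A ∣ * ∣ S ∣      ∎
    where
    open ≤-Reasoning
    hits≥2 : 2 ≤ hits A S ψ
    hits≥2 = subst (_≤ hits A S ψ) (cong₂ ℕ._+_ (hit a∈A ψ+a∈S) (hit b∈A ψ+b∈S))
                   (two-terms≤sum (incidence A S ψ) a≢b)

  module _ (Z : Subset n) where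

    Independent : Subset n → Set
    Independent = ZIndependent K Z

    independent-∪⁅⁆ : ∀ {A ψ b} → Independent A → (∀ {a} → a ∈ A → (ψ ⊕ a) ∈ Z) → (ψ ⊕ b) ∉ Z →
                      Independent (A ∪ ⁅ b ⁆)
    independent-∪⁅⁆ {A} {ψ} {b} indA ψ+A⊆Z ψ+b∉Z = shift (⊖ ψ) ind (isTranslate-inverse ψ+A∪⁅ψ+b⁆)
      where
      ψ+A⊆Z′ : translate ψ A ⊆ Z
      ψ+A⊆Z′ {x} x∈ψ+A with Equivalence.to (translate-isTranslate ψ A x) x∈ψ+A
      ... | α , α∈A , refl = ψ+A⊆Z α∈A
      ind : Independent (translate ψ A ∪ ⁅ ψ ⊕ b ⁆)
      ind = adjoin (ψ ⊕ b) (shift ψ indA (translate-isTranslate ψ A)) ψ+A⊆Z′ ψ+b∉Z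
      ψ+A∪⁅ψ+b⁆ : IsTranslate K ψ (A ∪ ⁅ b ⁆) (translate ψ A ∪ ⁅ ψ ⊕ b ⁆)
      ψ+A∪⁅ψ+b⁆ = isTranslate-∪⁅⁆ b (translate-isTranslate ψ A)

    independent-singleton : ∀ {x₀} → x₀ ∉ Z → ∀ a → Independent (⊥ ∪ ⁅ a ⁆)
    independent-singleton {x₀} x₀∉Z a =
      independent-∪⁅⁆ empty (⊥-elim ∘ ∉⊥) (subst (_∉ Z) (sym (//-rightDividesˡ a x₀)) x₀∉Z)

    independent-pair : ∀ {ψ a b} → (ψ ⊕ a) ∈ Z → (ψ ⊕ b) ∉ Z → Independent ((⊥ ∪ ⁅ a ⁆) ∪ ⁅ b ⁆)
    independent-pair {ψ} {a} ψ+a∈Z ψ+b∉Z = independent-∪⁅⁆ (independent-singleton ψ+b∉Z a) ψ+⁅a⁆⊆Z ψ+b∉Z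
      where
      ψ+⁅a⁆⊆Z : ∀ {a′} → a′ ∈ ⊥ ∪ ⁅ a ⁆ → (ψ ⊕ a′) ∈ Z
      ψ+⁅a⁆⊆Z a′∈ with x∈p∪q⁻ ⊥ ⁅ a ⁆ a′∈
      ... | inj₁ a′∈⊥ = ⊥-elim (∉⊥ a′∈⊥)
      ... | inj₂ a′∈⁅a⁆ rewrite x∈⁅y⁆⇒x≡y a a′∈⁅a⁆ = ψ+a∈Z

    translate⊈? : ∀ A ψ → Dec (∃ λ a → a ∈ A × (ψ ⊕ a) ∉ Z)
    translate⊈? A ψ = any? λ a → (a ∈? A) ×-dec ¬? ((ψ ⊕ a) ∈? Z)

    meets-or-avoids : ∀ A → TranslatesMeet A (∁ Z) ⊎ ∃ λ ψ → ∀ {a} → a ∈ A → (ψ ⊕ a) ∈ Z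
    meets-or-avoids A with all? (translate⊈? A)
    ... | yes cov = inj₁ λ ψ → let a , a∈A , ψ+a∉Z = cov ψ in a , a∈A , x∉p⇒x∈∁p ψ+a∉Z
    ... | no ¬cov with ¬∀⟶∃¬ n _ (translate⊈? A) ¬cov
    ...   | ψ , ψ+A⊈Z = inj₂ (ψ , λ {a} a∈A → decidable-stable ((ψ ⊕ a) ∈? Z) λ ψ+a∉Z → ψ+A⊈Z (a , a∈A , ψ+a∉Z))

    module _ {x₀} (x₀∉Z : x₀ ∉ Z) where

      meets-or-extends : ∀ {A} → Independent A →
                        TranslatesMeet A (∁ Z) ⊎ ∃ λ A′ → Independent A′ × A ⊆ A′ × ∣ A ∣ < ∣ A′ ∣
      meets-or-extends {A} indA with meets-or-avoids A
      ... | inj₁ cov = inj₁ cov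
      ... | inj₂ (ψ , ψ+A⊆Z) =
        inj₂ (A ∪ ⁅ b ⁆ , independent-∪⁅⁆ indA ψ+A⊆Z ψ+b∉Z , p⊆p∪q ⁅ b ⁆ ,
              p⊂q⇒∣p∣<∣q∣ (p⊆p∪q ⁅ b ⁆ , b , x∈p∪q⁺ (inj₂ (x∈⁅x⁆ b)) , ψ+b∉Z ∘ ψ+A⊆Z))
        where
        b = (⊖ ψ) ⊕ x₀
        ψ+b∉Z : (ψ ⊕ b) ∉ Z
        ψ+b∉Z = subst (_∉ Z) (sym (\\-leftDividesˡ ψ x₀)) x₀∉Z

      extend-until-meets : ∀ k {A} → Independent A → n ≤ k ℕ.+ ∣ A ∣ →
                        ∃ λ A′ → Independent A′ × A ⊆ A′ × TranslatesMeet A′ (∁ Z)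
      extend-until-meets k {A} indA n≤k+∣A∣ with meets-or-extends indA
      ... | inj₁ cov = A , indA , id , cov
      ... | inj₂ (A′ , indA′ , A⊆A′ , ∣A∣<∣A′∣) with k
      ...   | ℕ.zero = ⊥-elim (<⇒≱ (≤-trans ∣A∣<∣A′∣ (∣p∣≤n A′)) n≤k+∣A∣)
      ...   | suc k′ =
        let A″ , indA″ , A′⊆A″ , cov = extend-until-meets k′ indA′ (≤-trans n≤k+∣A∣ k+∣A∣<k′+∣A′∣)
        in A″ , indA″ , A′⊆A″ ∘ A⊆A′ , cov
        where
        k+∣A∣<k′+∣A′∣ : suc (k′ ℕ.+ ∣ A ∣) ≤ k′ ℕ.+ ∣ A′ ∣
        k+∣A∣<k′+∣A′∣ = ≤-trans (≤-reflexive (sym (+-suc k′ ∣ A ∣))) (+-monoʳ-≤ k′ ∣A∣<∣A′∣)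

      large-independent : Σ (Subset n) λ A → Independent A × ∣ A ∣ * ∣ ∁ Z ∣ ≥ n
      large-independent =
        let A , indA , _ , meets = extend-until-meets n empty (m≤m+n n ∣ ⊥ {n} ∣)
        in A , indA , meets⇒n≤∣A∣*∣S∣ meets

    module _ {q} (n≡q*∣∁Z∣ : n ≡ q * ∣ ∁ Z ∣) (bounded : ∀ A → Independent A → ∣ A ∣ ≤ q) where

      independent-meets-once : ∀ {A y a b} → Independent A → a ≢ b → a ∈ A → b ∈ A →
                               (y ⊕ a) ∈ ∁ Z → (y ⊕ b) ∉ ∁ Z
      independent-meets-once {A} indA a≢b a∈A b∈A y+a∈∁Z y+b∈∁Z =
        let A′ , indA′ , A⊆A′ , meets = extend-until-meets (x∈∁p⇒x∉p y+a∈∁Z) n indA (m≤m+n n _)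
        in <⇒≱ (meets-twice⇒n<∣A∣*∣S∣ meets a≢b (A⊆A′ a∈A) (A⊆A′ b∈A) y+a∈∁Z y+b∈∁Z) (begin
          ∣ A′ ∣ * ∣ ∁ Z ∣  ≤⟨ *-monoˡ-≤ ∣ ∁ Z ∣ (bounded A′ indA′) ⟩
          q * ∣ ∁ Z ∣       ≡⟨ n≡q*∣∁Z∣ ⟨
          n                 ∎)
        where open ≤-Reasoning

      ∁Z-transfer : ∀ {y ψ a b} → (y ⊕ a) ∈ ∁ Z → (y ⊕ b) ∈ ∁ Z → (ψ ⊕ a) ∈ ∁ Z → (ψ ⊕ b) ∈ ∁ Z
      ∁Z-transfer {y} {ψ} {a} {b} y+a∈∁Z y+b∈∁Z ψ+a∈∁Z = x∉p⇒x∈∁p ψ+b∉Z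
        where
        ψ+a∉Z : (ψ ⊕ a) ∉ Z
        ψ+a∉Z = x∈∁p⇒x∉p ψ+a∈∁Z
        b∈pair : b ∈ (⊥ ∪ ⁅ b ⁆) ∪ ⁅ a ⁆
        b∈pair = x∈p∪q⁺ (inj₁ (x∈p∪q⁺ (inj₂ (x∈⁅x⁆ b))))
        a∈pair : a ∈ (⊥ ∪ ⁅ b ⁆) ∪ ⁅ a ⁆
        a∈pair = x∈p∪q⁺ (inj₂ (x∈⁅x⁆ a))
        ψ+b∉Z : (ψ ⊕ b) ∉ Z
        ψ+b∉Z ψ+b∈Z = independent-meets-once (independent-pair ψ+b∈Z ψ+a∉Z) (λ { refl → ψ+a∉Z ψ+b∈Z })
                                            b∈pair a∈pair y+b∈∁Z y+a∈∁Z

      ∁Z-isCoset : ∀ {g} → g ∉ Z → IsCoset K (∁ Z)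
      ∁Z-isCoset {g} g∉Z = isCoset-stabiliser g∈∁Z (∈-decSubset⁺ (stabilises? (∁ Z)) ∘ stabilises)
        where
        g∈∁Z : g ∈ ∁ Z
        g∈∁Z = x∉p⇒x∈∁p g∉Z
        +0# : ∀ {x} → x ∈ ∁ Z → (x ⊕ 0#) ∈ ∁ Z
        +0# = subst (_∈ ∁ Z) (sym (identityʳ _))
        -0# : ∀ {x} → (x ⊕ 0#) ∈ ∁ Z → x ∈ ∁ Z
        -0# = subst (_∈ ∁ Z) (identityʳ _)
        stabilises : ∀ {α} → (g ⊕ α) ∈ ∁ Z → Stabilises (∁ Z) α
        stabilises g+α∈∁Z x = ∁Z-transfer (+0# g∈∁Z) g+α∈∁Z ∘ +0# , -0# ∘ ∁Z-transfer g+α∈∁Z (+0# g∈∁Z)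

mainTheorem9 : (K : FinAbGroup) → (Z : Subset (FinAbGroup.n K)) →
    ∃ (λ (x : Fin (FinAbGroup.n K)) → x ∉ Z) →
    (Σ (Subset (FinAbGroup.n K)) λ A →
       ZIndependent K Z A × ∣ A ∣ * ∣ ∁ Z ∣ ≥ FinAbGroup.n K)
    × ((d : ∣ ∁ Z ∣ ∣ FinAbGroup.n K) →
       (Σ (Subset (FinAbGroup.n K)) λ A → ZIndependent K Z A × ∣ A ∣ ≡ quotient d) →
       (∀ A → ZIndependent K Z A → ∣ A ∣ ≤ quotient d) →
       IsCoset K (∁ Z))
mainTheorem9 K Z (x₀ , x₀∉Z) =
  large-independent K Z x₀∉Z ,
  λ { (divides q n≡q*∣∁Z∣) _ bounded → ∁Z-isCoset K Z n≡q*∣∁Z∣ bounded x₀∉Z }
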